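{- Let $G$ be a graph without isolated vertices and let $v\in V(G)$ be such that $\mathrm{CC}(G)[N_{\mathrm{CC}(G)}([v]_G)]$ is a clique. Let $\mathcal{C}$ be a minimum-weight sigma clique cover of $G$ and let $C^* := N_G(v)\cup\{v\}$. Then $C^*\in\mathcal{C}$, and $C^*$ is the only set of $\mathcal{C}$ that contains $v$.
   Context: Graphs are finite, simple, undirected. A \emph{sigma clique cover} of $G$ is a set $\mathcal{C}$ of subsets of $V(G)$ such that $G[C]$ is a clique for every $C\in\mathcal{C}$ and every edge of $G$ has both endpoints in some $C\in\mathcal{C}$; its weight is $\sum_{C\in\mathcal{C}}|C|$. Let $R_G$ be the equivalence relation on $V(G)$ with $(v,w)\in R_G$ iff $N(v)\cup\{v\}=N(w)\cup\{w\}$; $[v]_G$ is the class of $v$ (a \emph{critical clique}). The \emph{critical clique graph} $\mathrm{CC}(G)$ has vertex set $\{[v]_G : v\in V(G)\}$ and edge set $\{[v]_G[w]_G : vw\in E(G),\ [v]_G\ne[w]_G\}$. -}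

module Defs where

open import Data.Nat using (ℕ; _≤_)
open import Data.Bool using (Bool; true; false; _∨_)
open import Data.Fin using (Fin; _≟_)
open import Data.Fin.Subset using (Subset; ∣_∣) renaming (_∈_ to _∈ₛ_)
open import Data.Vec using (tabulate)
open import Data.List using (List; map)
open import Data.Nat.ListAction using (sum)
open import Data.List.Membership.Propositional using (_∈_)
open import Data.List.Relation.Unary.Unique.Propositional using (Unique)
open import Data.Product using (Σ; ∃; ∃-syntax; _×_)
open import Relation.Binary.PropositionalEquality using (_≡_; _≢_)
open import Relation.Nullary using (¬_; does)

record Graph : Set where
  field
    n      : ℕ
    adj    : Fin n → Fin n → Bool
    sym    : ∀ x y → adj x y ≡ adj y x
    irrefl : ∀ x → adj x x ≡ false

module _ (G : Graph) where
  open Graph G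

  Vertex : Set
  Vertex = Fin n

  Edge : Vertex → Vertex → Set
  Edge x y = adj x y ≡ true

  closedNbhd : Vertex → Subset n
  closedNbhd v = tabulate (λ w → does (v ≟ w) ∨ adj v w)

  NoIsolated : Set
  NoIsolated = ∀ v → ∃[ w ] Edge v w

  -- R_G : N[v] = N[w]  (vertices of CC(G) are R_G-classes, represented
  -- by their elements)
  R : Vertex → Vertex → Set
  R v w = closedNbhd v ≡ closedNbhd w

  CCEdge : Vertex → Vertex → Set
  CCEdge x y = ¬ R x y × ∃[ x' ] ∃[ y' ] (R x' x × R y' y × Edge x' y')

  CCNbhdClique : Vertex → Set
  CCNbhdClique v = ∀ w u → CCEdge v w → CCEdge v u → ¬ R w u → CCEdge w u

  IsClique : Subset n → Set
  IsClique C = ∀ x y → x ∈ₛ C → y ∈ₛ C → x ≢ y → Edge x y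

  -- a sigma clique cover: a set (duplicate-free list) of subsets of V(G)
  -- each inducing a clique, covering every edge
  IsSigmaCliqueCover : List (Subset n) → Set
  IsSigmaCliqueCover 𝒞 =
    Unique 𝒞 ×
    (∀ C → C ∈ 𝒞 → IsClique C) ×
    (∀ x y → Edge x y → ∃[ C ] (C ∈ 𝒞 × x ∈ₛ C × y ∈ₛ C))

  weight : List (Subset n) → ℕ
  weight 𝒞 = sum (map ∣_∣ 𝒞)

  IsMinSigmaCliqueCover : List (Subset n) → Set
  IsMinSigmaCliqueCover 𝒞 =
    IsSigmaCliqueCover 𝒞 × (∀ 𝒟 → IsSigmaCliqueCover 𝒟 → weight 𝒞 ≤ weight 𝒟)

-- By the hypothesis on CC(G), N[v] is a clique, and every clique through v lies in N[v].
-- Replacing the members of 𝒞 through v by the single set N[v] therefore gives another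
-- sigma clique cover, so by minimality the members through v have total size at most
-- |N[v]|. They cover N[v] (v is not isolated) and all contain v; two or more of them
-- would count v twice and exceed |N[v]|, so there is exactly one, and it is N[v].
module Submission where

open import Defs
open import Data.Fin.Subset using (Subset) renaming (_∈_ to _∈ₛ_)
open import Data.List using (List)
open import Data.List.Membership.Propositional using (_∈_)
open import Data.Product using (_×_)
open import Relation.Binary.PropositionalEquality using (_≡_)

open import Data.Bool using (_∨_)
import Data.Bool as Bool
open import Data.Bool.Properties using (∨-zeroʳ)
open import Data.Fin using (Fin; _≟_)
open import Data.Fin.Subset using (∣_∣; _∪_; _∩_; _⊆_; ⋃; inside; outside)
open import Data.Fin.Subset.Properties
  using (_∈?_; ∉⊥; p⊆q⇒∣p∣≤∣q∣; ∣⊥∣≡0; ⊆-antisym; p⊆p∪q; q⊆p∪q; x∈p∩q⁺; ∪-identityʳ)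
open import Data.List using ([]; _∷_; map; filter)
open import Data.List.Membership.Propositional.Properties using (∈-filter⁺; ∈-filter⁻)
open import Data.List.Relation.Unary.All as All using (All; _∷_)
open import Data.List.Relation.Unary.All.Properties using (all-filter)
open import Data.List.Relation.Unary.AllPairs using (_∷_)
open import Data.List.Relation.Unary.Any using (here; there)
open import Data.List.Relation.Unary.Any.Properties using (singleton⁻)
import Data.List.Relation.Unary.Unique.Propositional.Properties as Unique
open import Data.List.Relation.Unary.Unique.Propositional using (Unique)
open import Data.Nat using (ℕ; suc; _+_; _≤_; _<_; z≤n; s≤s)
open import Data.Nat.ListAction using (sum)
open import Data.Nat.Properties
  using (+-suc; +-assoc; +-commutativeSemigroup; m≤m+n; m<m+n; +-monoʳ-≤; +-cancelʳ-≤;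
         ≤-reflexive; ≤-trans; module ≤-Reasoning; <-≤-trans; ≤-<-trans; <⇒≱)
open import Algebra.Properties.CommutativeSemigroup +-commutativeSemigroup using (x∙yz≈y∙xz)
open import Data.Product using (∃-syntax; _,_; proj₁; proj₂)
open import Data.Sum using (_⊎_; inj₁; inj₂)
open import Data.Vec using ([]; _∷_) renaming (here to hereᵥ; there to thereᵥ)
open import Data.Vec.Properties using (lookup∘tabulate; []=⇒lookup; lookup⇒[]=; ≡-dec)
open import Level using (Level)
open import Relation.Binary.PropositionalEquality using (refl; sym; trans; subst; cong; _≢_; module ≡-Reasoning)
open import Relation.Nullary using (¬_; Dec; yes; no; does; contradiction)
open import Relation.Nullary.Decidable using (dec-true)
open import Relation.Unary using (Pred; Decidable)
open import Relation.Unary.Properties using (∁?)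

private
  variable
    a p : Level
    A : Set a
    n : ℕ

sum-map-filter : (f : A → ℕ) {P : Pred A p} (P? : Decidable P) (xs : List A) →
  sum (map f xs) ≡ sum (map f (filter P? xs)) + sum (map f (filter (∁? P?) xs))
sum-map-filter f P? [] = refl
sum-map-filter f P? (x ∷ xs) with P? x
... | yes _ = trans (cong (f x +_) (sum-map-filter f P? xs)) (sym (+-assoc (f x) _ _))
... | no _  = trans (cong (f x +_) (sum-map-filter f P? xs))
  (x∙yz≈y∙xz (f x) (sum (map f (filter P? xs))) (sum (map f (filter (∁? P?) xs))))

∣p∪q∣+∣p∩q∣≡∣p∣+∣q∣ : (p q : Subset n) → ∣ p ∪ q ∣ + ∣ p ∩ q ∣ ≡ ∣ p ∣ + ∣ q ∣
∣p∪q∣+∣p∩q∣≡∣p∣+∣q∣ [] [] = refl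
∣p∪q∣+∣p∩q∣≡∣p∣+∣q∣ (inside ∷ p) (inside ∷ q) = cong suc (begin
  ∣ p ∪ q ∣ + suc ∣ p ∩ q ∣  ≡⟨ +-suc ∣ p ∪ q ∣ ∣ p ∩ q ∣ ⟩
  suc (∣ p ∪ q ∣ + ∣ p ∩ q ∣) ≡⟨ cong suc (∣p∪q∣+∣p∩q∣≡∣p∣+∣q∣ p q) ⟩
  suc (∣ p ∣ + ∣ q ∣)         ≡⟨ +-suc ∣ p ∣ ∣ q ∣ ⟨
  ∣ p ∣ + suc ∣ q ∣           ∎)
  where open ≡-Reasoning
∣p∪q∣+∣p∩q∣≡∣p∣+∣q∣ (inside ∷ p) (outside ∷ q) = cong suc (∣p∪q∣+∣p∩q∣≡∣p∣+∣q∣ p q)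
∣p∪q∣+∣p∩q∣≡∣p∣+∣q∣ (outside ∷ p) (inside ∷ q) =
  trans (cong suc (∣p∪q∣+∣p∩q∣≡∣p∣+∣q∣ p q)) (sym (+-suc ∣ p ∣ ∣ q ∣))
∣p∪q∣+∣p∩q∣≡∣p∣+∣q∣ (outside ∷ p) (outside ∷ q) = ∣p∪q∣+∣p∩q∣≡∣p∣+∣q∣ p q

x∈p⇒0<∣p∣ : {x : Fin n} {p : Subset n} → x ∈ₛ p → 0 < ∣ p ∣
x∈p⇒0<∣p∣ hereᵥ                          = s≤s z≤n
x∈p⇒0<∣p∣ {p = inside  ∷ _} (thereᵥ _)   = s≤s z≤n
x∈p⇒0<∣p∣ {p = outside ∷ _} (thereᵥ x∈p) = x∈p⇒0<∣p∣ x∈p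

∣p∪q∣≤∣p∣+∣q∣ : (p q : Subset n) → ∣ p ∪ q ∣ ≤ ∣ p ∣ + ∣ q ∣
∣p∪q∣≤∣p∣+∣q∣ p q = subst (∣ p ∪ q ∣ ≤_) (∣p∪q∣+∣p∩q∣≡∣p∣+∣q∣ p q) (m≤m+n _ _)

∣p∪q∣<∣p∣+∣q∣ : {x : Fin n} (p q : Subset n) → x ∈ₛ p → x ∈ₛ q → ∣ p ∪ q ∣ < ∣ p ∣ + ∣ q ∣
∣p∪q∣<∣p∣+∣q∣ p q x∈p x∈q =
  subst (∣ p ∪ q ∣ <_) (∣p∪q∣+∣p∩q∣≡∣p∣+∣q∣ p q) (m<m+n _ (x∈p⇒0<∣p∣ (x∈p∩q⁺ (x∈p , x∈q))))

totalSize : List (Subset n) → ℕ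
totalSize 𝒮 = sum (map ∣_∣ 𝒮)

x∈⋃⁺ : {x : Fin n} {C : Subset n} {𝒮 : List (Subset n)} → C ∈ 𝒮 → x ∈ₛ C → x ∈ₛ ⋃ 𝒮
x∈⋃⁺ {𝒮 = C ∷ 𝒮} (here refl) x∈C = p⊆p∪q (⋃ 𝒮) x∈C
x∈⋃⁺ {𝒮 = C ∷ 𝒮} (there C∈𝒮) x∈C = q⊆p∪q C (⋃ 𝒮) (x∈⋃⁺ C∈𝒮 x∈C)

∣⋃∣≤totalSize : (𝒮 : List (Subset n)) → ∣ ⋃ 𝒮 ∣ ≤ totalSize 𝒮
∣⋃∣≤totalSize {n} []    = ≤-reflexive (∣⊥∣≡0 n)
∣⋃∣≤totalSize (C ∷ 𝒮) = ≤-trans (∣p∪q∣≤∣p∣+∣q∣ C (⋃ 𝒮)) (+-monoʳ-≤ ∣ C ∣ (∣⋃∣≤totalSize 𝒮))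

∣⋃∣<totalSize : {x : Fin n} (C C′ : Subset n) (𝒮 : List (Subset n)) →
  All (x ∈ₛ_) (C ∷ C′ ∷ 𝒮) → ∣ ⋃ (C ∷ C′ ∷ 𝒮) ∣ < totalSize (C ∷ C′ ∷ 𝒮)
∣⋃∣<totalSize C C′ 𝒮 (x∈C ∷ x∈C′ ∷ _) = <-≤-trans
  (∣p∪q∣<∣p∣+∣q∣ C (⋃ (C′ ∷ 𝒮)) x∈C (p⊆p∪q (⋃ 𝒮) x∈C′))
  (+-monoʳ-≤ ∣ C ∣ (∣⋃∣≤totalSize (C′ ∷ 𝒮)))

tight-star⇒≡[_] : {x : Fin n} {D : Subset n} (𝒮 : List (Subset n)) →
  x ∈ₛ D → All (x ∈ₛ_) 𝒮 → All (_⊆ D) 𝒮 → D ⊆ ⋃ 𝒮 → totalSize 𝒮 ≤ ∣ D ∣ → 𝒮 ≡ D ∷ []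
tight-star⇒≡[_] [] x∈D _ _ D⊆⋃𝒮 _ = contradiction (D⊆⋃𝒮 x∈D) ∉⊥
tight-star⇒≡[_] (C ∷ []) _ _ (C⊆D ∷ _) D⊆⋃𝒮 _ =
  cong (_∷ []) (⊆-antisym C⊆D (λ y∈D → subst (_ ∈ₛ_) (∪-identityʳ C) (D⊆⋃𝒮 y∈D)))
tight-star⇒≡[_] (C ∷ C′ ∷ 𝒮) _ x∈𝒮 _ D⊆⋃𝒮 light =
  contradiction light (<⇒≱ (≤-<-trans (p⊆q⇒∣p∣≤∣q∣ D⊆⋃𝒮) (∣⋃∣<totalSize C C′ 𝒮 x∈𝒮)))

containing avoiding : Fin n → List (Subset n) → List (Subset n)
containing x = filter (x ∈?_)
avoiding   x = filter (∁? (x ∈?_))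

module _ (G : Graph) where
  open Graph G using (adj) renaming (sym to adj-sym)

  private
    N[_] : Vertex G → Subset (Graph.n G)
    N[_] = closedNbhd G

  Edge-sym : ∀ {x y} → Edge G x y → Edge G y x
  Edge-sym {x} {y} = trans (adj-sym y x)

  ∈closedNbhd⁻ : ∀ {u x} → x ∈ₛ N[ u ] → u ≡ x ⊎ Edge G u x
  ∈closedNbhd⁻ {u} {x} x∈N[u] with u ≟ x | trans (sym (lookup∘tabulate _ x)) ([]=⇒lookup x∈N[u])
  ... | yes u≡x | _   = inj₁ u≡x
  ... | no _    | u~x = inj₂ u~x

  ∈closedNbhd⁺ : ∀ {u x} → u ≡ x ⊎ Edge G u x → x ∈ₛ N[ u ]
  ∈closedNbhd⁺ {u} {x} h = lookup⇒[]= x N[ u ] (trans (lookup∘tabulate _ x) (indicator h))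
    where
    indicator : u ≡ x ⊎ Edge G u x → does (u ≟ x) ∨ adj u x ≡ Bool.true
    indicator (inj₁ u≡x) = cong (_∨ adj u x) (dec-true (u ≟ x) u≡x)
    indicator (inj₂ u~x) = trans (cong (does (u ≟ x) ∨_) u~x) (∨-zeroʳ _)

  closedNbhd-refl : ∀ u → u ∈ₛ N[ u ]
  closedNbhd-refl u = ∈closedNbhd⁺ (inj₁ refl)

  closedNbhd-sym : ∀ {u x} → x ∈ₛ N[ u ] → u ∈ₛ N[ x ]
  closedNbhd-sym x∈N[u] with ∈closedNbhd⁻ x∈N[u]
  ... | inj₁ u≡x = ∈closedNbhd⁺ (inj₁ (sym u≡x))
  ... | inj₂ u~x = ∈closedNbhd⁺ (inj₂ (Edge-sym u~x))

  closedNbhd⇒Edge : ∀ {u x} → x ∈ₛ N[ u ] → u ≢ x → Edge G u x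
  closedNbhd⇒Edge x∈N[u] u≢x with ∈closedNbhd⁻ x∈N[u]
  ... | inj₁ u≡x = contradiction u≡x u≢x
  ... | inj₂ u~x = u~x

  R? : ∀ x y → Dec (R G x y)
  R? x y = ≡-dec Bool._≟_ N[ x ] N[ y ]

  -- y′ ∈ N[x′] = N[x], hence x ∈ N[y′] = N[y].
  Edge-resp-R : ∀ {x x′ y y′} → R G x x′ → R G y y′ → Edge G x′ y′ → x ≢ y → Edge G x y
  Edge-resp-R {x} {x′} {y} {y′} xRx′ yRy′ x′~y′ =
    closedNbhd⇒Edge (closedNbhd-sym (subst (x ∈ₛ_) (sym yRy′)
      (closedNbhd-sym (subst (y′ ∈ₛ_) (sym xRx′) (∈closedNbhd⁺ (inj₂ x′~y′))))))

  clique⊆closedNbhd : ∀ {v C} → IsClique G C → v ∈ₛ C → C ⊆ N[ v ]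
  clique⊆closedNbhd {v} {C} C-clique v∈C {x} x∈C with v ≟ x
  ... | yes v≡x = ∈closedNbhd⁺ (inj₁ v≡x)
  ... | no  v≢x = ∈closedNbhd⁺ (inj₂ (C-clique v x v∈C x∈C v≢x))

  module _ {v : Vertex G} (N[v]-CC-clique : CCNbhdClique G v) where

    neighbours-adjacent : ∀ {x y} → Edge G v x → Edge G v y → x ≢ y → Edge G x y
    neighbours-adjacent {x} {y} v~x v~y x≢y with R? v x | R? v y | R? x y
    ... | yes vRx | _       | _   = Edge-resp-R (sym vRx) refl v~y x≢y
    ... | no _    | yes vRy | _   = Edge-resp-R refl (sym vRy) (Edge-sym v~x) x≢y
    ... | no _    | no _    | yes xRy =
      closedNbhd⇒Edge (subst (y ∈ₛ_) (sym xRy) (closedNbhd-refl y)) x≢y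
    ... | no ¬vRx | no ¬vRy | no ¬xRy
      with N[v]-CC-clique x y (¬vRx , v , x , refl , refl , v~x) (¬vRy , v , y , refl , refl , v~y) ¬xRy
    ...   | _ , x′ , y′ , x′Rx , y′Ry , x′~y′ = Edge-resp-R (sym x′Rx) (sym y′Ry) x′~y′ x≢y

    closedNbhd-isClique : IsClique G N[ v ]
    closedNbhd-isClique x y x∈N[v] y∈N[v] x≢y with ∈closedNbhd⁻ x∈N[v] | ∈closedNbhd⁻ y∈N[v]
    ... | inj₁ refl | inj₁ refl = contradiction refl x≢y
    ... | inj₁ refl | inj₂ v~y  = v~y
    ... | inj₂ v~x  | inj₁ refl = Edge-sym v~x
    ... | inj₂ v~x  | inj₂ v~y  = neighbours-adjacent v~x v~y x≢y

  replace-star : ∀ {v D 𝒞} → IsClique G D → v ∈ₛ D → (∀ C → IsClique G C → v ∈ₛ C → C ⊆ D) →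
    IsSigmaCliqueCover G 𝒞 → IsSigmaCliqueCover G (D ∷ avoiding v 𝒞)
  replace-star {v} {D} {𝒞} D-clique v∈D cliques-through-v⊆D (𝒞-unique , 𝒞-cliques , 𝒞-covers) =
    unique , cliques , covers
    where
    ∈avoiding⁻ : ∀ {C} → C ∈ avoiding v 𝒞 → C ∈ 𝒞 × ¬ v ∈ₛ C
    ∈avoiding⁻ = ∈-filter⁻ (∁? (v ∈?_))

    unique : Unique (D ∷ avoiding v 𝒞)
    unique = All.tabulate (λ C∈ D≡C → proj₂ (∈avoiding⁻ C∈) (subst (v ∈ₛ_) D≡C v∈D))
           ∷ Unique.filter⁺ (∁? (v ∈?_)) 𝒞-unique

    cliques : ∀ C → C ∈ D ∷ avoiding v 𝒞 → IsClique G C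
    cliques C (here refl) = D-clique
    cliques C (there C∈)  = 𝒞-cliques C (proj₁ (∈avoiding⁻ C∈))

    covers : ∀ x y → Edge G x y → ∃[ C ] (C ∈ D ∷ avoiding v 𝒞 × x ∈ₛ C × y ∈ₛ C)
    covers x y x~y with 𝒞-covers x y x~y
    ... | C , C∈𝒞 , x∈C , y∈C with v ∈? C
    ...   | yes v∈C = D , here refl , C⊆D x∈C , C⊆D y∈C
      where C⊆D = cliques-through-v⊆D C (𝒞-cliques C C∈𝒞) v∈C
    ...   | no  v∉C = C , there (∈-filter⁺ (∁? (v ∈?_)) C∈𝒞 v∉C) , x∈C , y∈C

  Edge⇒∈⋃containing : ∀ {v x 𝒞} → IsSigmaCliqueCover G 𝒞 → Edge G v x →
    v ∈ₛ ⋃ (containing v 𝒞) × x ∈ₛ ⋃ (containing v 𝒞)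
  Edge⇒∈⋃containing {v} {x} (_ , _ , 𝒞-covers) v~x with 𝒞-covers v x v~x
  ... | C , C∈𝒞 , v∈C , x∈C = x∈⋃⁺ C∈containing v∈C , x∈⋃⁺ C∈containing x∈C
    where C∈containing = ∈-filter⁺ (v ∈?_) C∈𝒞 v∈C

  closedNbhd⊆⋃containing : ∀ {v 𝒞} → ∃[ w ] Edge G v w → IsSigmaCliqueCover G 𝒞 →
    N[ v ] ⊆ ⋃ (containing v 𝒞)
  closedNbhd⊆⋃containing (_ , v~w) 𝒞-cover x∈N[v] with ∈closedNbhd⁻ x∈N[v]
  ... | inj₁ refl = proj₁ (Edge⇒∈⋃containing 𝒞-cover v~w)
  ... | inj₂ v~x  = proj₂ (Edge⇒∈⋃containing 𝒞-cover v~x)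

  containing⊆closedNbhd : ∀ {v 𝒞} → (∀ C → C ∈ 𝒞 → IsClique G C) → All (_⊆ N[ v ]) (containing v 𝒞)
  containing⊆closedNbhd {v} {𝒞} 𝒞-cliques = All.tabulate λ {C} C∈ →
    let C∈𝒞 , v∈C = ∈-filter⁻ (v ∈?_) {xs = 𝒞} C∈ in clique⊆closedNbhd (𝒞-cliques C C∈𝒞) v∈C

lemma6 : (G : Graph) → NoIsolated G → (v : Vertex G) → CCNbhdClique G v →
    (𝒞 : List (Subset (Graph.n G))) → IsMinSigmaCliqueCover G 𝒞 →
    (closedNbhd G v ∈ 𝒞) ×
    (∀ C → C ∈ 𝒞 → v ∈ₛ C → C ≡ closedNbhd G v)
lemma6 G no-isolated v N[v]-CC-clique 𝒞 (𝒞-cover@(_ , 𝒞-cliques , _) , 𝒞-minimal) =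
  proj₁ (∈-filter⁻ (v ∈?_) (subst (N[v] ∈_) (sym star≡[N[v]]) (here refl))) ,
  λ C C∈𝒞 v∈C → singleton⁻ (subst (C ∈_) star≡[N[v]] (∈-filter⁺ (v ∈?_) C∈𝒞 v∈C))
  where
  N[v] = closedNbhd G v
  star = containing v 𝒞

  star-light : totalSize star ≤ ∣ N[v] ∣
  star-light = +-cancelʳ-≤ (totalSize (avoiding v 𝒞)) (totalSize star) ∣ N[v] ∣ (begin
    totalSize star + totalSize (avoiding v 𝒞) ≡⟨ sum-map-filter ∣_∣ (v ∈?_) 𝒞 ⟨
    totalSize 𝒞                               ≤⟨ 𝒞-minimal _ (replace-star G
                                                   (closedNbhd-isClique G N[v]-CC-clique)
                                                   (closedNbhd-refl G v)
                                                   (λ _ → clique⊆closedNbhd G) 𝒞-cover) ⟩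
    ∣ N[v] ∣ + totalSize (avoiding v 𝒞)       ∎)
    where open ≤-Reasoning

  star≡[N[v]] : star ≡ N[v] ∷ []
  star≡[N[v]] = tight-star⇒≡[ star ] (closedNbhd-refl G v) (all-filter (v ∈?_) 𝒞)
    (containing⊆closedNbhd G 𝒞-cliques)
    (closedNbhd⊆⋃containing G (no-isolated v) 𝒞-cover) star-light
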